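{- Let $K$ be an $(n-1)$-dimensional simplicial complex on $m$ vertices, let $l>0$ be an integer, and let $lK=K(l,\ldots,l)=K(\partial\Delta_{[l]},\ldots,\partial\Delta_{[l]})$. Then $$h_{lK}(t)=(1+t+\cdots+t^{l-1})^{m-n}\,h_K(t^l).$$
   Context: A simplicial complex on a finite set $V$ is a family of subsets of $V$ closed under taking subsets (ghost vertices allowed; $m$ counts all elements of the vertex set). $\partial\Delta_{[l]}$ is the complex on $[l]$ of all proper subsets of $[l]$. For $K$ on $[m]$ and $K_i$ on $[l_i]$, the composition $K(K_1,\ldots,K_m)$ is the complex on $[l_1]\sqcup\cdots\sqcup[l_m]$ in which $I=I_1\sqcup\cdots\sqcup I_m$ is a simplex iff $\{i\mid I_i\notin K_i\}\in K$. For a complex $K$ of dimension $n-1$, $f_i=|\{I\in K\mid |I|=i\}|$, $f_K(t)=\sum_i f_it^i$, and the $h$-polynomial is $h_K(t)=(1-t)^nf_K\big(\tfrac{t}{1-t}\big)$, where $n=\dim K+1$ for the complex in question. -}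

module Defs where

open import Level using (Level)
open import Data.Bool using (Bool; true; false; not; _∧_; T)
open import Data.Bool.Properties using () renaming (_≟_ to _≟B_)
open import Data.Nat using (ℕ; zero; suc; _∸_; _≤_; _≡ᵇ_)
open import Data.Nat as ℕ using ()
open import Data.List using (List; []; _∷_; _++_; map; length; filterᵇ)
open import Data.Vec using (Vec; []; _∷_; take; drop; lookup; tabulate)
open import Data.Vec.Properties using (≡-dec)
open import Data.Fin using (Fin)
open import Data.Fin.Subset using (Subset; _⊆_; ∣_∣; ⊤; ⊥)
open import Data.Product using (Σ; _×_; _,_)
open import Relation.Nullary.Decidable using (⌊_⌋)
open import Relation.Binary.PropositionalEquality using (_≡_)
open import Algebra.Bundles using (CommutativeRing)

-- A family of subsets of the vertex set [N] = Fin N, given as a Boolean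
-- membership test.  Ghost vertices are allowed (N counts all vertices).
Family : ℕ → Set
Family N = Subset N → Bool

IsComplex : {N : ℕ} → Family N → Set
IsComplex {N} K = ∀ (I J : Subset N) → J ⊆ I → T (K I) → T (K J)

HasEmpty : {N : ℕ} → Family N → Set
HasEmpty K = T (K ⊥)

IsDimPlusOne : {N : ℕ} → Family N → ℕ → Set
IsDimPlusOne {N} K n =
  (Σ (Subset N) λ I → T (K I) × ∣ I ∣ ≡ n) ×
  (∀ (I : Subset N) → T (K I) → ∣ I ∣ ≤ n)

boundarySimplex : (l : ℕ) → Family l
boundarySimplex l I = not ⌊ ≡-dec _≟B_ I ⊤ ⌋

chunks : {A : Set} (m l : ℕ) → Vec A (m ℕ.* l) → Vec (Vec A l) m
chunks zero    l []  = []
chunks (suc m) l xs  = take l xs ∷ chunks m l (drop l xs)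

-- Composition K(K_1,...,K_m) with all K_i on [l]; vertex set [l]⊔...⊔[l] = Fin (m*l),
-- the i-th copy of [l] being the i-th block of l consecutive elements.
compose : {m l : ℕ} → Family m → (Fin m → Family l) → Family (m ℕ.* l)
compose {m} {l} K Ks I =
  K (tabulate λ i → not (Ks i (lookup (chunks m l I) i)))

multK : {m : ℕ} (l : ℕ) → Family m → Family (m ℕ.* l)
multK l K = compose K (λ _ → boundarySimplex l)

allSubsets : (N : ℕ) → List (Subset N)
allSubsets zero    = [] ∷ []
allSubsets (suc N) = map (true ∷_) (allSubsets N) ++ map (false ∷_) (allSubsets N)

fNum : {N : ℕ} → Family N → ℕ → ℕ
fNum {N} K i = length (filterᵇ (λ I → K I ∧ (∣ I ∣ ≡ᵇ i)) (allSubsets N))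

module _ {c ℓ : Level} (R : CommutativeRing c ℓ) where
  open CommutativeRing R using (Carrier; _+_; _*_; _-_; 0#; 1#)

  natMul : ℕ → Carrier → Carrier
  natMul zero    x = 0#
  natMul (suc k) x = x + natMul k x

  pow : Carrier → ℕ → Carrier
  pow x zero    = 1#
  pow x (suc k) = x * pow x k

  sumUpTo : ℕ → (ℕ → Carrier) → Carrier
  sumUpTo zero    g = g zero
  sumUpTo (suc n) g = sumUpTo n g + g (suc n)

  -- h_K(t) = (1-t)^n f_K(t/(1-t)) = Σ_{i=0}^{n} f_i t^i (1-t)^{n-i},  n = dim K + 1
  hEval : {N : ℕ} → Family N → ℕ → Carrier → Carrier
  hEval K n t = sumUpTo n λ i → natMul (fNum K i) (pow t i * pow (1# - t) (n ∸ i))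

  geomSum : ℕ → Carrier → Carrier
  geomSum zero    t = 0#
  geomSum (suc l) t = pow t l + geomSum l t

-- Write l = k + 1 and split the vertex set of lK into m blocks of l vertices.  A subset J lies
-- in lK iff the set σ of blocks that J fills completely lies in K, and |J| ≤ mk + |σ| with
-- equality attained, so dim lK + 1 = mk + n.  Hence h_{lK}(t) is the sum over J ∈ lK of
-- t^|J| (1-t)^(mk+n-|J|), which factors block by block: a full block contributes t^l, and the
-- non-full subsets A of a block together contribute Σ t^|A| (1-t)^(k-|A|) = 1 + t + ⋯ + t^k =: g.
-- This gives h_{lK}(t) = Σ_{σ ∈ K} t^(l|σ|) g^(m-|σ|) (1-t)^(n-|σ|), and since g (1-t) = 1 - t^l
-- the right-hand side is g^(m-n) h_K(t^l).
module Submission where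

open import Defs
open import Level using (Level)
open import Algebra.Bundles using (CommutativeRing)
open import Data.Bool using (Bool; true; false; not; _∧_; T)
open import Data.Bool.Properties using (T-not-≡) renaming (_≟_ to _≟B_)
open import Data.Fin.Subset using (Subset; ∣_∣; ⊤)
open import Data.Fin.Subset.Properties using (∣p∣≤n; ∣⊤∣≡n; ∣p∣≡n⇒p≡⊤)
open import Data.List as List using (List; []; _∷_; map; length; filterᵇ)
open import Data.Nat as ℕ using (ℕ; zero; suc; _∸_; _≤_; _<_; _≡ᵇ_; z≤n; s≤s; s≤s⁻¹)
import Data.Nat.Properties as ℕ
open import Data.Product using (_,_; proj₂)
open import Data.Sum using (inj₁; inj₂)
open import Data.Vec using (Vec; []; _∷_; _++_; take; drop; tabulate; lookup)
open import Data.Vec.Properties using (≡-dec; take++drop≡id)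
open import Function.Bundles using (Equivalence)
open import Relation.Nullary using (¬_; yes; no)
open import Relation.Nullary.Negation using (contradiction)
import Relation.Binary.PropositionalEquality as ≡
open ≡ using (_≡_; _≢_; cong; cong₂; subst)

module Blocks where
  open import Data.Nat using (_+_; _*_)
  open import Data.Nat.Properties
  open ≡ using (refl; sym; trans)

  -- multK l K J unfolds to K (fullBlocks m l J): a block of J counts iff it is all of [l].
  isFull : ∀ {l} → Subset l → Bool
  isFull {l} A = not (boundarySimplex l A)

  fullBlocks : ∀ m l → Subset (m * l) → Subset m
  fullBlocks m l J = tabulate λ i → isFull (lookup (chunks m l J) i)

  isFull-⊤ : ∀ l → isFull (⊤ {l}) ≡ true
  isFull-⊤ l with ≡-dec _≟B_ (⊤ {l}) ⊤
  ... | yes _   = refl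
  ... | no  ⊤≢⊤ = contradiction refl ⊤≢⊤

  isFull-true∷ : ∀ {l} (A : Subset l) → isFull (true ∷ A) ≡ isFull A
  isFull-true∷ A with ≡-dec _≟B_ A ⊤
  ... | yes _ = refl
  ... | no  _ = refl

  ¬isFull⇒∣p∣<n : ∀ {l} (A : Subset l) → T (not (isFull A)) → ∣ A ∣ < l
  ¬isFull⇒∣p∣<n {l} A notFull = ≤∧≢⇒< (∣p∣≤n A) λ ∣A∣≡l →
    contradiction (trans (cong isFull (∣p∣≡n⇒p≡⊤ {p = A} ∣A∣≡l)) (isFull-⊤ l))
                  (λ full → subst (λ b → T (not b)) full notFull)

  take-++ : ∀ {X : Set} {a b} (xs : Vec X a) (ys : Vec X b) → take a (xs ++ ys) ≡ xs
  take-++ []       ys = refl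
  take-++ (x ∷ xs) ys = cong (x ∷_) (take-++ xs ys)

  drop-++ : ∀ {X : Set} {a b} (xs : Vec X a) (ys : Vec X b) → drop a (xs ++ ys) ≡ ys
  drop-++ []       ys = refl
  drop-++ (x ∷ xs) ys = drop-++ xs ys

  ∣p++q∣≡∣p∣+∣q∣ : ∀ {a b} (p : Subset a) (q : Subset b) → ∣ p ++ q ∣ ≡ ∣ p ∣ + ∣ q ∣
  ∣p++q∣≡∣p∣+∣q∣ []          q = refl
  ∣p++q∣≡∣p∣+∣q∣ (true  ∷ p) q = cong suc (∣p++q∣≡∣p∣+∣q∣ p q)
  ∣p++q∣≡∣p∣+∣q∣ (false ∷ p) q = ∣p++q∣≡∣p∣+∣q∣ p q

  fullBlocks-++ : ∀ m {l} (A : Subset l) (B : Subset (m * l)) →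
                  fullBlocks (suc m) l (A ++ B) ≡ isFull A ∷ fullBlocks m l B
  fullBlocks-++ m A B =
    cong₂ (λ A′ B′ → isFull A′ ∷ fullBlocks m _ B′) (take-++ A B) (drop-++ A B)

  [m+n]+1+o≡1+m+[n+o] : ∀ m n o → (m + n) + suc o ≡ suc m + (n + o)
  [m+n]+1+o≡1+m+[n+o] m n o = trans (+-suc (m + n) o) (cong suc (+-assoc m n o))

  [m+n]∸[o+p]≡[m∸o]+[n∸p] : ∀ {m n o p} → o ≤ m → p ≤ n →
                            (m + n) ∸ (o + p) ≡ (m ∸ o) + (n ∸ p)
  [m+n]∸[o+p]≡[m∸o]+[n∸p] {m} {n} {o} {p} o≤m p≤n = begin
    (m + n) ∸ (o + p)  ≡⟨ ∸-+-assoc (m + n) o p ⟨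
    (m + n) ∸ o ∸ p    ≡⟨ cong (_∸ p) (+-∸-comm n o≤m) ⟩
    (m ∸ o + n) ∸ p    ≡⟨ +-∸-assoc (m ∸ o) p≤n ⟩
    (m ∸ o) + (n ∸ p)  ∎
    where open ≡.≡-Reasoning

  m∸o≡[m∸n]+[n∸o] : ∀ {m n o} → o ≤ n → n ≤ m → m ∸ o ≡ (m ∸ n) + (n ∸ o)
  m∸o≡[m∸n]+[n∸o] {o = o} o≤n n≤m =
    trans (cong (_∸ o) (sym (m∸n+n≡m n≤m))) (+-∸-assoc _ o≤n)

  ∣p∣≤m*k+∣fullBlocks∣ : ∀ m k (J : Subset (m * suc k)) →
                         ∣ J ∣ ≤ m * k + ∣ fullBlocks m (suc k) J ∣
  ∣p∣≤m*k+∣fullBlocks∣ zero    k [] = z≤n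
  ∣p∣≤m*k+∣fullBlocks∣ (suc m) k J = begin
    ∣ J ∣                           ≡⟨ cong ∣_∣ (take++drop≡id (suc k) J) ⟨
    ∣ A ++ B ∣                      ≡⟨ ∣p++q∣≡∣p∣+∣q∣ A B ⟩
    ∣ A ∣ + ∣ B ∣                   ≤⟨ +-monoʳ-≤ ∣ A ∣ (∣p∣≤m*k+∣fullBlocks∣ m k B) ⟩
    ∣ A ∣ + (m * k + ∣ σ ∣)         ≤⟨ block≤ ⟩
    (k + m * k) + ∣ isFull A ∷ σ ∣  ∎
    where
    open ≤-Reasoning
    A : Subset (suc k)
    A = take (suc k) J
    B : Subset (m * suc k)
    B = drop (suc k) J
    σ : Subset m
    σ = fullBlocks m (suc k) B
    block≤ : ∣ A ∣ + (m * k + ∣ σ ∣) ≤ (k + m * k) + ∣ isFull A ∷ σ ∣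
    block≤ with isFull A in full
    ... | true  = ≤-trans (+-monoˡ-≤ _ (∣p∣≤n A))
                          (≤-reflexive (sym ([m+n]+1+o≡1+m+[n+o] k (m * k) ∣ σ ∣)))
    ... | false = ≤-trans (+-monoˡ-≤ _ (s≤s⁻¹ (¬isFull⇒∣p∣<n A (Equivalence.from T-not-≡ full))))
                          (≤-reflexive (sym (+-assoc k (m * k) ∣ σ ∣)))

  -- The largest subset whose full blocks are exactly σ: every other block misses one vertex.
  fill : ∀ m k → Subset m → Subset (m * suc k)
  fill zero    k []          = []
  fill (suc m) k (true  ∷ σ) = ⊤ ++ fill m k σ
  fill (suc m) k (false ∷ σ) = (false ∷ ⊤) ++ fill m k σ

  fullBlocks-fill : ∀ m k (σ : Subset m) → fullBlocks m (suc k) (fill m k σ) ≡ σ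
  fullBlocks-fill zero    k []          = refl
  fullBlocks-fill (suc m) k (true  ∷ σ) = trans (fullBlocks-++ m ⊤ (fill m k σ))
    (cong₂ _∷_ (isFull-⊤ (suc k)) (fullBlocks-fill m k σ))
  fullBlocks-fill (suc m) k (false ∷ σ) = trans (fullBlocks-++ m (false ∷ ⊤) (fill m k σ))
    (cong (false ∷_) (fullBlocks-fill m k σ))

  ∣fill∣≡m*k+∣σ∣ : ∀ m k (σ : Subset m) → ∣ fill m k σ ∣ ≡ m * k + ∣ σ ∣
  ∣fill∣≡m*k+∣σ∣ zero    k []          = refl
  ∣fill∣≡m*k+∣σ∣ (suc m) k (true  ∷ σ) = begin
    ∣ ⊤ {suc k} ++ fill m k σ ∣     ≡⟨ ∣p++q∣≡∣p∣+∣q∣ (⊤ {suc k}) (fill m k σ) ⟩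
    ∣ ⊤ {suc k} ∣ + ∣ fill m k σ ∣  ≡⟨ cong₂ _+_ (∣⊤∣≡n (suc k)) (∣fill∣≡m*k+∣σ∣ m k σ) ⟩
    suc k + (m * k + ∣ σ ∣)         ≡⟨ [m+n]+1+o≡1+m+[n+o] k (m * k) ∣ σ ∣ ⟨
    (k + m * k) + suc ∣ σ ∣         ∎
    where open ≡.≡-Reasoning
  ∣fill∣≡m*k+∣σ∣ (suc m) k (false ∷ σ) = begin
    ∣ ⊤ {k} ++ fill m k σ ∣         ≡⟨ ∣p++q∣≡∣p∣+∣q∣ (⊤ {k}) (fill m k σ) ⟩
    ∣ ⊤ {k} ∣ + ∣ fill m k σ ∣      ≡⟨ cong₂ _+_ (∣⊤∣≡n k) (∣fill∣≡m*k+∣σ∣ m k σ) ⟩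
    k + (m * k + ∣ σ ∣)             ≡⟨ +-assoc k (m * k) ∣ σ ∣ ⟨
    (k + m * k) + ∣ σ ∣             ∎
    where open ≡.≡-Reasoning

  IsDimPlusOne⇒≤ : ∀ {m n} {K : Family m} → IsDimPlusOne K n → n ≤ m
  IsDimPlusOne⇒≤ ((σ , _ , ∣σ∣≡n) , _) = subst (_≤ _) ∣σ∣≡n (∣p∣≤n σ)

  IsDimPlusOne-unique : ∀ {N n n′} {K : Family N} →
                        IsDimPlusOne K n → IsDimPlusOne K n′ → n ≡ n′
  IsDimPlusOne-unique ((I , I∈K , ∣I∣≡n) , ≤n) ((I′ , I′∈K , ∣I′∣≡n′) , ≤n′) =
    ≤-antisym (subst (_≤ _) ∣I∣≡n (≤n′ I I∈K)) (subst (_≤ _) ∣I′∣≡n′ (≤n I′ I′∈K))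

  IsDimPlusOne-multK : ∀ {m n} k (K : Family m) → IsDimPlusOne K n →
                       IsDimPlusOne (multK (suc k) K) (m * k + n)
  IsDimPlusOne-multK {m} k K ((σ , σ∈K , ∣σ∣≡n) , ≤n) =
    ( fill m k σ
    , subst (λ τ → T (K τ)) (sym (fullBlocks-fill m k σ)) σ∈K
    , trans (∣fill∣≡m*k+∣σ∣ m k σ) (cong (m * k +_) ∣σ∣≡n) )
    , λ J J∈lK → ≤-trans (∣p∣≤m*k+∣fullBlocks∣ m k J) (+-monoʳ-≤ (m * k) (≤n _ J∈lK))

link₀ : ∀ {m} → Family (suc m) → Family m
link₀ F σ = F (true ∷ σ)

deletion₀ : ∀ {m} → Family (suc m) → Family m
deletion₀ F σ = F (false ∷ σ)

open Blocks

module _ {r ℓ} (R : CommutativeRing r ℓ) where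
  open CommutativeRing R hiding (zero)
  open import Algebra.Properties.CommutativeSemiring.Exp commutativeSemiring
    using (_^_; ^-congˡ; ^-homo-*; ^-distrib-*)
  open import Algebra.Properties.CommutativeSemigroup +-commutativeSemigroup
    using (interchange)
  open import Algebra.Properties.CommutativeSemigroup *-commutativeSemigroup
    using (x∙yz≈y∙xz) renaming (interchange to *-interchange)
  open import Algebra.Properties.Group +-group using (//-rightDividesˡ; //-rightDividesʳ)
  open import Algebra.Solver.Ring.NaturalCoefficients.Default commutativeSemiring
  open import Relation.Binary.Reasoning.Setoid setoid

  pow≡^ : ∀ x n → pow R x n ≡ x ^ n
  pow≡^ x zero    = ≡.refl
  pow≡^ x (suc n) = cong (x *_) (pow≡^ x n)

  1^n≈1 : ∀ n → 1# ^ n ≈ 1#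
  1^n≈1 zero    = refl
  1^n≈1 (suc n) = trans (*-identityˡ _) (1^n≈1 n)

  infixl 5 _when_
  _when_ : Carrier → Bool → Carrier
  v when true  = v
  v when false = 0#

  when-cong : ∀ b {v w} → (T b → v ≈ w) → v when b ≈ w when b
  when-cong true  v≈w = v≈w _
  when-cong false _   = refl

  *-when : ∀ b a v → a * v when b ≈ a * (v when b)
  *-when true  a v = refl
  *-when false a v = sym (zeroʳ a)

  when-T : ∀ b v → T b → v when b ≈ v
  when-T true v _ = refl

  when-¬T : ∀ b v → ¬ T b → v when b ≈ 0#
  when-¬T true  v ¬b = contradiction _ ¬b
  when-¬T false v ¬b = refl

  ∑ : ∀ {X : Set} → List X → (X → Carrier) → Carrier
  ∑ []       f = 0#
  ∑ (x ∷ xs) f = f x + ∑ xs f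

  ∑-cong : ∀ {X : Set} (xs : List X) {f g : X → Carrier} → (∀ x → f x ≈ g x) → ∑ xs f ≈ ∑ xs g
  ∑-cong []       f≈g = refl
  ∑-cong (x ∷ xs) f≈g = +-cong (f≈g x) (∑-cong xs f≈g)

  ∑-++ : ∀ {X : Set} (xs ys : List X) f → ∑ (xs List.++ ys) f ≈ ∑ xs f + ∑ ys f
  ∑-++ []       ys f = sym (+-identityˡ _)
  ∑-++ (x ∷ xs) ys f = trans (+-congˡ (∑-++ xs ys f)) (sym (+-assoc _ _ _))

  ∑-map : ∀ {X Y : Set} (h : X → Y) (xs : List X) f → ∑ (map h xs) f ≡ ∑ xs (λ x → f (h x))
  ∑-map h []       f = ≡.refl
  ∑-map h (x ∷ xs) f = cong (f (h x) +_) (∑-map h xs f)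

  ∑-*ˡ : ∀ {X : Set} (xs : List X) a f → ∑ xs (λ x → a * f x) ≈ a * ∑ xs f
  ∑-*ˡ []       a f = sym (zeroʳ a)
  ∑-*ˡ (x ∷ xs) a f = trans (+-congˡ (∑-*ˡ xs a f)) (sym (distribˡ a _ _))

  ∑-when-factorˡ : ∀ {X : Set} (xs : List X) {P : X → Bool} {f g : X → Carrier} a →
                   (∀ x → T (P x) → f x ≈ a * g x) →
                   ∑ xs (λ x → f x when P x) ≈ a * ∑ xs (λ x → g x when P x)
  ∑-when-factorˡ xs {P} {g = g} a f≈ag = trans
    (∑-cong xs λ x → trans (when-cong (P x) (f≈ag x)) (*-when (P x) a (g x)))
    (∑-*ˡ xs a _)

  ∑-when-factorʳ : ∀ {X : Set} (xs : List X) {P : X → Bool} {f g : X → Carrier} a →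
                   (∀ x → T (P x) → f x ≈ g x * a) →
                   ∑ xs (λ x → f x when P x) ≈ ∑ xs (λ x → g x when P x) * a
  ∑-when-factorʳ xs a f≈ga = trans
    (∑-when-factorˡ xs a λ x Px → trans (f≈ga x Px) (*-comm _ a))
    (*-comm a _)

  ∑Subsets : ∀ N → (Subset N → Carrier) → Carrier
  ∑Subsets N = ∑ (allSubsets N)

  ∑Subsets-suc : ∀ N f → ∑Subsets (suc N) f
                          ≈ ∑Subsets N (λ A → f (true ∷ A)) + ∑Subsets N (λ A → f (false ∷ A))
  ∑Subsets-suc N f = begin
    ∑ (map (true ∷_) (allSubsets N) List.++ map (false ∷_) (allSubsets N)) f
      ≈⟨ ∑-++ (map (true ∷_) (allSubsets N)) _ f ⟩
    ∑ (map (true ∷_) (allSubsets N)) f + ∑ (map (false ∷_) (allSubsets N)) f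
      ≡⟨ cong₂ _+_ (∑-map (true ∷_) (allSubsets N) f) (∑-map (false ∷_) (allSubsets N) f) ⟩
    ∑Subsets N (λ A → f (true ∷ A)) + ∑Subsets N (λ A → f (false ∷ A)) ∎

  ∑Subsets-++ : ∀ a b f → ∑Subsets (a ℕ.+ b) f ≈ ∑Subsets a (λ A → ∑Subsets b (λ B → f (A ++ B)))
  ∑Subsets-++ zero    b f = sym (+-identityʳ _)
  ∑Subsets-++ (suc a) b f = trans (∑Subsets-suc (a ℕ.+ b) f)
    (trans (+-cong (∑Subsets-++ a b _) (∑Subsets-++ a b _)) (sym (∑Subsets-suc a _)))

  ∑Subsets-blocks : ∀ m l (φ : Subset (suc m) → ℕ → Carrier) →
    ∑Subsets (suc m ℕ.* l) (λ J → φ (fullBlocks (suc m) l J) ∣ J ∣)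
      ≈ ∑Subsets l (λ A → ∑Subsets (m ℕ.* l) (λ B →
          φ (isFull A ∷ fullBlocks m l B) (∣ A ∣ ℕ.+ ∣ B ∣)))
  ∑Subsets-blocks m l φ = trans (∑Subsets-++ l (m ℕ.* l) _)
    (∑-cong (allSubsets l) λ A → ∑-cong (allSubsets (m ℕ.* l)) λ B →
      reflexive (cong₂ φ (fullBlocks-++ m A B) (∣p++q∣≡∣p∣+∣q∣ A B)))

  ∑Subsets-split-isFull : ∀ l (ψ : Bool → Subset l → Carrier) →
    ∑Subsets l (λ A → ψ (isFull A) A) ≈ ψ true ⊤ + ∑Subsets l (λ A → ψ false A when not (isFull A))
  ∑Subsets-split-isFull zero    ψ = +-congˡ (sym (+-identityˡ 0#))
  ∑Subsets-split-isFull (suc l) ψ = begin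
    ∑Subsets (suc l) (λ A → ψ (isFull A) A)
      ≈⟨ ∑Subsets-suc l _ ⟩
    ∑Subsets l (λ A → ψ (isFull (true ∷ A)) (true ∷ A)) + rest
      ≈⟨ +-congʳ (∑-cong (allSubsets l) λ A →
           reflexive (cong (λ b → ψ b (true ∷ A)) (isFull-true∷ A))) ⟩
    ∑Subsets l (λ A → ψ (isFull A) (true ∷ A)) + rest
      ≈⟨ +-congʳ (∑Subsets-split-isFull l (λ b A → ψ b (true ∷ A))) ⟩
    (ψ true ⊤ + ∑Subsets l (λ A → ψ false (true ∷ A) when not (isFull A))) + rest
      ≈⟨ +-assoc _ _ _ ⟩
    ψ true ⊤ + (∑Subsets l (λ A → ψ false (true ∷ A) when not (isFull A)) + rest)
      ≈⟨ +-congˡ (+-congʳ (∑-cong (allSubsets l) λ A →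
           reflexive (cong (λ b → ψ false (true ∷ A) when not b) (isFull-true∷ A)))) ⟨
    ψ true ⊤ + (∑Subsets l (λ A → ψ false (true ∷ A) when not (isFull (true ∷ A))) + rest)
      ≈⟨ +-congˡ (∑Subsets-suc l _) ⟨
    ψ true ⊤ + ∑Subsets (suc l) (λ A → ψ false A when not (isFull A)) ∎
    where
    rest : Carrier
    rest = ∑Subsets l (λ A → ψ false (false ∷ A))

  sumUpTo-cong : ∀ n {f g : ℕ → Carrier} → (∀ i → f i ≈ g i) → sumUpTo R n f ≈ sumUpTo R n g
  sumUpTo-cong zero    f≈g = f≈g zero
  sumUpTo-cong (suc n) f≈g = +-cong (sumUpTo-cong n f≈g) (f≈g (suc n))

  sumUpTo-+ : ∀ n f g → sumUpTo R n (λ i → f i + g i) ≈ sumUpTo R n f + sumUpTo R n g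
  sumUpTo-+ zero    f g = refl
  sumUpTo-+ (suc n) f g = trans (+-congʳ (sumUpTo-+ n f g)) (interchange _ _ _ _)

  sumUpTo-0 : ∀ n → sumUpTo R n (λ _ → 0#) ≈ 0#
  sumUpTo-0 zero    = refl
  sumUpTo-0 (suc n) = trans (+-identityʳ _) (sumUpTo-0 n)

  when-≡ᵇ-≢ : ∀ {a i} v → a ≢ i → v when (a ≡ᵇ i) ≈ 0#
  when-≡ᵇ-≢ {a} {i} v a≢i = when-¬T (a ≡ᵇ i) v (λ a≡ᵇi → a≢i (ℕ.≡ᵇ⇒≡ a i a≡ᵇi))

  sumUpTo-when-≡ᵇ-< : ∀ {a} n (w : ℕ → Carrier) → n < a →
                      sumUpTo R n (λ i → w i when (a ≡ᵇ i)) ≈ 0#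
  sumUpTo-when-≡ᵇ-< zero    w 0<a = when-≡ᵇ-≢ (w zero) (ℕ.>⇒≢ 0<a)
  sumUpTo-when-≡ᵇ-< (suc n) w n<a = trans
    (+-cong (sumUpTo-when-≡ᵇ-< n w (ℕ.<⇒≤ n<a)) (when-≡ᵇ-≢ (w (suc n)) (ℕ.>⇒≢ n<a)))
    (+-identityʳ 0#)

  sumUpTo-when-≡ᵇ : ∀ {a} n (w : ℕ → Carrier) → a ≤ n →
                    sumUpTo R n (λ i → w i when (a ≡ᵇ i)) ≈ w a
  sumUpTo-when-≡ᵇ zero    w z≤n = refl
  sumUpTo-when-≡ᵇ (suc n) w a≤1+n with ℕ.m≤n⇒m<n∨m≡n a≤1+n
  ... | inj₁ a<1+n  = trans
    (+-cong (sumUpTo-when-≡ᵇ n w (s≤s⁻¹ a<1+n)) (when-≡ᵇ-≢ (w (suc n)) (ℕ.<⇒≢ a<1+n)))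
    (+-identityʳ _)
  ... | inj₂ ≡.refl = trans
    (+-cong (sumUpTo-when-≡ᵇ-< n w ℕ.≤-refl)
            (when-T (suc n ≡ᵇ suc n) _ (ℕ.≡⇒≡ᵇ (suc n) (suc n) ≡.refl)))
    (+-identityˡ _)

  natMul-filterᵇ-∷ : ∀ {X : Set} (p : X → Bool) x xs a →
    natMul R (length (filterᵇ p (x ∷ xs))) a ≈ (a when p x) + natMul R (length (filterᵇ p xs)) a
  natMul-filterᵇ-∷ p x xs a with p x
  ... | true  = refl
  ... | false = sym (+-identityˡ _)

  sumUpTo-count : ∀ {X : Set} (P : X → Bool) (size : X → ℕ) n (w : ℕ → Carrier) (xs : List X) →
    (∀ x → T (P x) → size x ≤ n) →
    sumUpTo R n (λ i → natMul R (length (filterᵇ (λ x → P x ∧ (size x ≡ᵇ i)) xs)) (w i))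
      ≈ ∑ xs (λ x → w (size x) when P x)
  sumUpTo-count P size n w []       _     = sumUpTo-0 n
  sumUpTo-count P size n w (x ∷ xs) bound = begin
    sumUpTo R n (λ i → count (x ∷ xs) i)
      ≈⟨ sumUpTo-cong n (λ i → natMul-filterᵇ-∷ _ x xs (w i)) ⟩
    sumUpTo R n (λ i → (w i when (P x ∧ (size x ≡ᵇ i))) + count xs i)
      ≈⟨ sumUpTo-+ n _ _ ⟩
    sumUpTo R n (λ i → w i when (P x ∧ (size x ≡ᵇ i))) + sumUpTo R n (count xs)
      ≈⟨ +-cong head (sumUpTo-count P size n w xs bound) ⟩
    (w (size x) when P x) + ∑ xs (λ y → w (size y) when P y) ∎
    where
    count : List _ → ℕ → Carrier
    count ys i = natMul R (length (filterᵇ (λ y → P y ∧ (size y ≡ᵇ i)) ys)) (w i)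
    head : sumUpTo R n (λ i → w i when (P x ∧ (size x ≡ᵇ i))) ≈ w (size x) when P x
    head with P x in Px
    ... | true  = sumUpTo-when-≡ᵇ n w (bound x (subst T (≡.sym Px) _))
    ... | false = sumUpTo-0 n

  binomialTerm : Carrier → Carrier → ℕ → ℕ → Carrier
  binomialTerm x y n i = x ^ i * y ^ (n ∸ i)

  binomialTerm-+ : ∀ x y {m n i j} → i ≤ m → j ≤ n →
    binomialTerm x y (m ℕ.+ n) (i ℕ.+ j) ≈ binomialTerm x y m i * binomialTerm x y n j
  binomialTerm-+ x y {m} {n} {i} {j} i≤m j≤n = begin
    x ^ (i ℕ.+ j) * y ^ ((m ℕ.+ n) ∸ (i ℕ.+ j))
      ≡⟨ cong (λ e → x ^ (i ℕ.+ j) * y ^ e) ([m+n]∸[o+p]≡[m∸o]+[n∸p] i≤m j≤n) ⟩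
    x ^ (i ℕ.+ j) * y ^ ((m ∸ i) ℕ.+ (n ∸ j))
      ≈⟨ *-cong (^-homo-* x i j) (^-homo-* y (m ∸ i) (n ∸ j)) ⟩
    (x ^ i * x ^ j) * (y ^ (m ∸ i) * y ^ (n ∸ j))
      ≈⟨ *-interchange _ _ _ _ ⟩
    (x ^ i * y ^ (m ∸ i)) * (x ^ j * y ^ (n ∸ j)) ∎

  binomialTerm-diag : ∀ x y n → binomialTerm x y n n ≈ x ^ n
  binomialTerm-diag x y n =
    trans (reflexive (cong (λ e → x ^ n * y ^ e) (ℕ.n∸n≡0 n))) (*-identityʳ _)

  ∑Subsets-binomialTerm : ∀ x y N → ∑Subsets N (λ A → binomialTerm x y N ∣ A ∣) ≈ (x + y) ^ N
  ∑Subsets-binomialTerm x y zero    = trans (+-identityʳ _) (*-identityˡ 1#)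
  ∑Subsets-binomialTerm x y (suc N) = begin
    ∑Subsets (suc N) (λ A → binomialTerm x y (suc N) ∣ A ∣)
      ≈⟨ ∑Subsets-suc N _ ⟩
    ∑Subsets N (λ A → x * x ^ ∣ A ∣ * y ^ (N ∸ ∣ A ∣))
      + ∑Subsets N (λ A → x ^ ∣ A ∣ * y ^ (suc N ∸ ∣ A ∣))
      ≈⟨ +-cong (∑-cong (allSubsets N) λ A → *-assoc _ _ _) (∑-cong (allSubsets N) yTerm) ⟩
    ∑Subsets N (λ A → x * binomialTerm x y N ∣ A ∣) + ∑Subsets N (λ A → y * binomialTerm x y N ∣ A ∣)
      ≈⟨ +-cong (∑-*ˡ (allSubsets N) x _) (∑-*ˡ (allSubsets N) y _) ⟩
    x * S + y * S
      ≈⟨ distribʳ _ x y ⟨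
    (x + y) * S
      ≈⟨ *-congˡ (∑Subsets-binomialTerm x y N) ⟩
    (x + y) * (x + y) ^ N ∎
    where
    S : Carrier
    S = ∑Subsets N (λ A → binomialTerm x y N ∣ A ∣)
    yTerm : ∀ A → x ^ ∣ A ∣ * y ^ (suc N ∸ ∣ A ∣) ≈ y * binomialTerm x y N ∣ A ∣
    yTerm A = trans (reflexive (cong (λ e → x ^ ∣ A ∣ * y ^ e) (ℕ.+-∸-assoc 1 (∣p∣≤n A))))
                    (x∙yz≈y∙xz _ _ _)

  geomSum-suc : ∀ l x → geomSum R (suc l) x ≈ 1# + x * geomSum R l x
  geomSum-suc zero    x = +-congˡ (sym (zeroʳ x))
  geomSum-suc (suc l) x = begin
    x * pow R x l + geomSum R (suc l) x      ≈⟨ +-congˡ (geomSum-suc l x) ⟩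
    x * pow R x l + (1# + x * geomSum R l x) ≈⟨ solve 4 (λ x p a g → x :* p :+ (a :+ x :* g)
                                                            := a :+ x :* (p :+ g))
                                                        refl x (pow R x l) 1# (geomSum R l x) ⟩
    1# + x * (pow R x l + geomSum R l x)     ∎

  geomSum*[1-x]+x^l≈1 : ∀ l x → geomSum R l x * (1# - x) + x ^ l ≈ 1#
  geomSum*[1-x]+x^l≈1 zero    x = trans (+-congʳ (zeroˡ _)) (+-identityˡ 1#)
  geomSum*[1-x]+x^l≈1 (suc l) x = begin
    geomSum R (suc l) x * (1# - x) + x * x ^ l
      ≈⟨ +-congʳ (*-congʳ (geomSum-suc l x)) ⟩
    (1# + x * geomSum R l x) * (1# - x) + x * x ^ l
      ≈⟨ solve 4 (λ x g u p → (con 1 :+ x :* g) :* u :+ x :* p := u :+ x :* (g :* u :+ p))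
                 refl x (geomSum R l x) (1# - x) (x ^ l) ⟩
    (1# - x) + x * (geomSum R l x * (1# - x) + x ^ l)
      ≈⟨ +-congˡ (trans (*-congˡ (geomSum*[1-x]+x^l≈1 l x)) (*-identityʳ x)) ⟩
    (1# - x) + x
      ≈⟨ //-rightDividesˡ x 1# ⟩
    1# ∎

  geomSum*[1-x]≈1-x^l : ∀ l x → geomSum R l x * (1# - x) ≈ 1# - x ^ l
  geomSum*[1-x]≈1-x^l l x =
    sym (trans (+-congʳ (sym (geomSum*[1-x]+x^l≈1 l x))) (//-rightDividesʳ (x ^ l) _))

  nonFullSum : ℕ → Carrier → Carrier → Carrier
  nonFullSum k x y = ∑Subsets (suc k) (λ A → binomialTerm x y k ∣ A ∣ when not (isFull A))

  nonFullSum-suc : ∀ k x y → nonFullSum (suc k) x y ≈ x * nonFullSum k x y + (x + y) ^ suc k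
  nonFullSum-suc k x y = begin
    nonFullSum (suc k) x y
      ≈⟨ ∑Subsets-suc (suc k) _ ⟩
    ∑Subsets (suc k) (λ A → x * x ^ ∣ A ∣ * y ^ (k ∸ ∣ A ∣) when not (isFull (true ∷ A)))
      + ∑Subsets (suc k) (λ A → binomialTerm x y (suc k) ∣ A ∣)
      ≈⟨ +-cong (∑-cong (allSubsets (suc k)) λ A →
                   reflexive (cong (λ b → x * x ^ ∣ A ∣ * y ^ (k ∸ ∣ A ∣) when not b) (isFull-true∷ A)))
                (∑Subsets-binomialTerm x y (suc k)) ⟩
    ∑Subsets (suc k) (λ A → x * x ^ ∣ A ∣ * y ^ (k ∸ ∣ A ∣) when not (isFull A)) + (x + y) ^ suc k
      ≈⟨ +-congʳ (∑-when-factorˡ (allSubsets (suc k)) {P = λ A → not (isFull A)} x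
                    λ A _ → *-assoc _ _ _) ⟩
    x * nonFullSum k x y + (x + y) ^ suc k ∎

  nonFullSum≈geomSum : ∀ k x → nonFullSum k x (1# - x) ≈ geomSum R (suc k) x
  nonFullSum≈geomSum zero    x = solve 0 (con 0 :+ ((con 1 :* con 1) :+ con 0) := con 1 :+ con 0) refl
  nonFullSum≈geomSum (suc k) x = begin
    nonFullSum (suc k) x (1# - x)
      ≈⟨ nonFullSum-suc k x (1# - x) ⟩
    x * nonFullSum k x (1# - x) + (x + (1# - x)) ^ suc k
      ≈⟨ +-cong (*-congˡ (nonFullSum≈geomSum k x)) (trans (^-congˡ (suc k) x+[1-x]≈1) (1^n≈1 (suc k))) ⟩
    x * geomSum R (suc k) x + 1#
      ≈⟨ +-comm _ _ ⟩
    1# + x * geomSum R (suc k) x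
      ≈⟨ geomSum-suc (suc k) x ⟨
    geomSum R (suc (suc k)) x ∎
    where
    x+[1-x]≈1 : x + (1# - x) ≈ 1#
    x+[1-x]≈1 = trans (+-comm x _) (//-rightDividesˡ x 1#)

  faceSum : ∀ {N} → Family N → ℕ → Carrier → Carrier → Carrier
  faceSum {N} F n x y = ∑Subsets N (λ I → binomialTerm x y n ∣ I ∣ when F I)

  faceSum-congʳ : ∀ {N} (F : Family N) n x {y y′} → y ≈ y′ → faceSum F n x y ≈ faceSum F n x y′
  faceSum-congʳ {N} F n x y≈y′ =
    ∑-cong (allSubsets N) λ I → when-cong (F I) λ _ → *-congˡ (^-congˡ (n ∸ ∣ I ∣) y≈y′)

  hEval≈faceSum : ∀ {N} (F : Family N) n x → (∀ I → T (F I) → ∣ I ∣ ≤ n) →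
                  hEval R F n x ≈ faceSum F n x (1# - x)
  hEval≈faceSum {N} F n x bound = trans (sumUpTo-count F ∣_∣ n _ (allSubsets N) bound)
    (∑-cong (allSubsets N) λ I →
      reflexive (cong₂ (λ a b → a * b when F I) (pow≡^ x ∣ I ∣) (pow≡^ (1# - x) (n ∸ ∣ I ∣))))

  faceSum₃ : ∀ {m} → Family m → ℕ → Carrier → Carrier → Carrier → Carrier
  faceSum₃ {m} F n x y z =
    ∑Subsets m (λ σ → x ^ ∣ σ ∣ * y ^ (m ∸ ∣ σ ∣) * z ^ (n ∸ ∣ σ ∣) when F σ)

  faceSum₃-suc : ∀ {m} (F : Family (suc m)) n x y z →
    faceSum₃ F n x y z ≈ x * faceSum₃ (link₀ F) (n ∸ 1) x y z + y * faceSum₃ (deletion₀ F) n x y z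
  faceSum₃-suc {m} F n x y z = trans (∑Subsets-suc m _) (+-cong
    (∑-when-factorˡ (allSubsets m) {P = link₀ F} x λ σ _ → trans
      (reflexive (cong (λ e → x * x ^ ∣ σ ∣ * y ^ (m ∸ ∣ σ ∣) * z ^ e)
                       (≡.sym (ℕ.∸-+-assoc n 1 ∣ σ ∣))))
      (solve 4 (λ x a b c → x :* a :* b :* c := x :* (a :* b :* c)) refl x _ _ _))
    (∑-when-factorˡ (allSubsets m) {P = deletion₀ F} y λ σ _ → trans
      (reflexive (cong (λ e → x ^ ∣ σ ∣ * y ^ e * z ^ (n ∸ ∣ σ ∣)) (ℕ.+-∸-assoc 1 (∣p∣≤n σ))))
      (solve 4 (λ y a b c → a :* (y :* b) :* c := y :* (a :* b :* c)) refl y _ _ _)))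

  faceSum₃-factor : ∀ {m} (F : Family m) n x y z → n ≤ m → (∀ σ → T (F σ) → ∣ σ ∣ ≤ n) →
                    faceSum₃ F n x y z ≈ y ^ (m ∸ n) * faceSum F n x (y * z)
  faceSum₃-factor {m} F n x y z n≤m bound =
    ∑-when-factorˡ (allSubsets m) {P = F} (y ^ (m ∸ n)) λ σ face → begin
      x ^ ∣ σ ∣ * y ^ (m ∸ ∣ σ ∣) * z ^ (n ∸ ∣ σ ∣)
        ≡⟨ cong (λ e → x ^ ∣ σ ∣ * y ^ e * z ^ (n ∸ ∣ σ ∣))
                (m∸o≡[m∸n]+[n∸o] (bound σ face) n≤m) ⟩
      x ^ ∣ σ ∣ * y ^ ((m ∸ n) ℕ.+ (n ∸ ∣ σ ∣)) * z ^ (n ∸ ∣ σ ∣)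
        ≈⟨ *-congʳ (*-congˡ (^-homo-* y (m ∸ n) (n ∸ ∣ σ ∣))) ⟩
      x ^ ∣ σ ∣ * (y ^ (m ∸ n) * y ^ (n ∸ ∣ σ ∣)) * z ^ (n ∸ ∣ σ ∣)
        ≈⟨ solve 4 (λ a c b d → a :* (c :* b) :* d := c :* (a :* (b :* d))) refl _ _ _ _ ⟩
      y ^ (m ∸ n) * (x ^ ∣ σ ∣ * (y ^ (n ∸ ∣ σ ∣) * z ^ (n ∸ ∣ σ ∣)))
        ≈⟨ *-congˡ (*-congˡ (^-distrib-* y z (n ∸ ∣ σ ∣))) ⟨
      y ^ (m ∸ n) * binomialTerm x (y * z) n ∣ σ ∣ ∎

  module _ (x y : Carrier) (k : ℕ) where

    fullBlockSum : ∀ m (F : Family m) n → (∀ σ → T (F σ) → suc ∣ σ ∣ ≤ n) →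
      ∑Subsets (m ℕ.* suc k) (λ B →
        binomialTerm x y ((k ℕ.+ m ℕ.* k) ℕ.+ n) (∣ ⊤ {suc k} ∣ ℕ.+ ∣ B ∣) when multK (suc k) F B)
        ≈ x ^ suc k * faceSum (multK (suc k) F) (m ℕ.* k ℕ.+ (n ∸ 1)) x y
    fullBlockSum m F n bound =
      ∑-when-factorˡ (allSubsets (m ℕ.* suc k)) {P = multK (suc k) F} (x ^ suc k) λ B face →
        split B (bound _ face)
      where
      split : ∀ {n} B → suc ∣ fullBlocks m (suc k) B ∣ ≤ n →
        binomialTerm x y ((k ℕ.+ m ℕ.* k) ℕ.+ n) (∣ ⊤ {suc k} ∣ ℕ.+ ∣ B ∣)
          ≈ x ^ suc k * binomialTerm x y (m ℕ.* k ℕ.+ (n ∸ 1)) ∣ B ∣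
      split {suc n} B (s≤s σ≤n) = begin
        binomialTerm x y ((k ℕ.+ m ℕ.* k) ℕ.+ suc n) (∣ ⊤ {suc k} ∣ ℕ.+ ∣ B ∣)
          ≡⟨ cong₂ (binomialTerm x y) ([m+n]+1+o≡1+m+[n+o] k (m ℕ.* k) n)
                                      (cong (ℕ._+ ∣ B ∣) (∣⊤∣≡n (suc k))) ⟩
        binomialTerm x y (suc k ℕ.+ (m ℕ.* k ℕ.+ n)) (suc k ℕ.+ ∣ B ∣)
          ≈⟨ binomialTerm-+ x y {m = suc k} {i = suc k} ℕ.≤-refl
               (ℕ.≤-trans (∣p∣≤m*k+∣fullBlocks∣ m k B) (ℕ.+-monoʳ-≤ (m ℕ.* k) σ≤n)) ⟩
        binomialTerm x y (suc k) (suc k) * binomialTerm x y (m ℕ.* k ℕ.+ n) ∣ B ∣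
          ≈⟨ *-congʳ (binomialTerm-diag x y (suc k)) ⟩
        x ^ suc k * binomialTerm x y (m ℕ.* k ℕ.+ n) ∣ B ∣ ∎

    properBlocksSum : ∀ m (F : Family m) n → (∀ σ → T (F σ) → ∣ σ ∣ ≤ n) →
      ∑Subsets (suc k) (λ A → ∑Subsets (m ℕ.* suc k) (λ B →
          binomialTerm x y ((k ℕ.+ m ℕ.* k) ℕ.+ n) (∣ A ∣ ℕ.+ ∣ B ∣) when multK (suc k) F B)
        when not (isFull A))
        ≈ nonFullSum k x y * faceSum (multK (suc k) F) (m ℕ.* k ℕ.+ n) x y
    properBlocksSum m F n bound =
      ∑-when-factorʳ (allSubsets (suc k)) {P = λ A → not (isFull A)} _ λ A proper →
        ∑-when-factorˡ (allSubsets (m ℕ.* suc k)) {P = multK (suc k) F} _ λ B face → begin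
          binomialTerm x y ((k ℕ.+ m ℕ.* k) ℕ.+ n) (∣ A ∣ ℕ.+ ∣ B ∣)
            ≡⟨ cong (λ e → binomialTerm x y e (∣ A ∣ ℕ.+ ∣ B ∣)) (ℕ.+-assoc k (m ℕ.* k) n) ⟩
          binomialTerm x y (k ℕ.+ (m ℕ.* k ℕ.+ n)) (∣ A ∣ ℕ.+ ∣ B ∣)
            ≈⟨ binomialTerm-+ x y (s≤s⁻¹ (¬isFull⇒∣p∣<n A proper))
                 (ℕ.≤-trans (∣p∣≤m*k+∣fullBlocks∣ m k B)
                            (ℕ.+-monoʳ-≤ (m ℕ.* k) (bound _ face))) ⟩
          binomialTerm x y k ∣ A ∣ * binomialTerm x y (m ℕ.* k ℕ.+ n) ∣ B ∣ ∎

    faceSum-multK : ∀ m (F : Family m) n → (∀ σ → T (F σ) → ∣ σ ∣ ≤ n) →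
      faceSum (multK (suc k) F) (m ℕ.* k ℕ.+ n) x y ≈ faceSum₃ F n (x ^ suc k) (nonFullSum k x y) y
    faceSum-multK zero    F n _     = +-congʳ (when-cong (F []) λ _ → *-congʳ (sym (*-identityˡ 1#)))
    faceSum-multK (suc m) F n bound = begin
      faceSum (multK (suc k) F) (suc m ℕ.* k ℕ.+ n) x y
        ≈⟨ ∑Subsets-blocks m (suc k) (λ σ i → binomialTerm x y (suc m ℕ.* k ℕ.+ n) i when F σ) ⟩
      ∑Subsets (suc k) (λ A → blockSum (isFull A) A)
        ≈⟨ ∑Subsets-split-isFull (suc k) blockSum ⟩
      blockSum true ⊤ + ∑Subsets (suc k) (λ A → blockSum false A when not (isFull A))
        ≈⟨ +-cong (fullBlockSum m (link₀ F) n λ σ → bound (true ∷ σ))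
                  (properBlocksSum m (deletion₀ F) n λ σ → bound (false ∷ σ)) ⟩
      x ^ suc k * faceSum (multK (suc k) (link₀ F)) (m ℕ.* k ℕ.+ (n ∸ 1)) x y
        + g * faceSum (multK (suc k) (deletion₀ F)) (m ℕ.* k ℕ.+ n) x y
        ≈⟨ +-cong (*-congˡ (faceSum-multK m (link₀ F) (n ∸ 1) λ σ face →
                              ℕ.∸-monoˡ-≤ 1 (bound (true ∷ σ) face)))
                  (*-congˡ (faceSum-multK m (deletion₀ F) n λ σ → bound (false ∷ σ))) ⟩
      x ^ suc k * faceSum₃ (link₀ F) (n ∸ 1) (x ^ suc k) g y + g * faceSum₃ (deletion₀ F) n (x ^ suc k) g y
        ≈⟨ faceSum₃-suc F n _ _ _ ⟨
      faceSum₃ F n (x ^ suc k) g y ∎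
      where
      g : Carrier
      g = nonFullSum k x y
      blockSum : Bool → Subset (suc k) → Carrier
      blockSum b A = ∑Subsets (m ℕ.* suc k) (λ B →
        binomialTerm x y (suc m ℕ.* k ℕ.+ n) (∣ A ∣ ℕ.+ ∣ B ∣) when F (b ∷ fullBlocks m (suc k) B))

mainTheorem15 : ∀ {c ℓ : Level} (m n l : ℕ) (K : Family m) →
    IsComplex K → HasEmpty K → IsDimPlusOne K n → 0 < l →
    (n' : ℕ) → IsDimPlusOne (multK l K) n' →
    (R : CommutativeRing c ℓ) → (t : CommutativeRing.Carrier R) →
    CommutativeRing._≈_ R (hEval R (multK l K) n' t)
      (CommutativeRing._*_ R (pow R (geomSum R l t) (m ∸ n)) (hEval R K n (pow R t l)))
mainTheorem15 m n (suc k) K _ _ dimK (s≤s z≤n) n' dimlK R t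
  with IsDimPlusOne-unique dimlK (IsDimPlusOne-multK k K dimK)
... | ≡.refl = begin
  hEval R (multK l K) (m ℕ.* k ℕ.+ n) t
    ≈⟨ hEval≈faceSum R (multK l K) _ t (proj₂ dimlK) ⟩
  faceSum R (multK l K) (m ℕ.* k ℕ.+ n) t (1# - t)
    ≈⟨ faceSum-multK R t (1# - t) k m K n (proj₂ dimK) ⟩
  faceSum₃ R K n (t ^ l) g′ (1# - t)
    ≈⟨ faceSum₃-factor R K n _ _ _ (IsDimPlusOne⇒≤ dimK) (proj₂ dimK) ⟩
  g′ ^ (m ∸ n) * faceSum R K n (t ^ l) (g′ * (1# - t))
    ≈⟨ *-cong (^-congˡ (m ∸ n) g′≈g)
              (faceSum-congʳ R K n _ (trans (*-congʳ g′≈g) (geomSum*[1-x]≈1-x^l R l t))) ⟩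
  g ^ (m ∸ n) * faceSum R K n (t ^ l) (1# - t ^ l)
    ≈⟨ *-congˡ (hEval≈faceSum R K n (t ^ l) (proj₂ dimK)) ⟨
  g ^ (m ∸ n) * hEval R K n (t ^ l)
    ≡⟨ cong₂ (λ a b → a * hEval R K n b) (pow≡^ R g (m ∸ n)) (pow≡^ R t l) ⟨
  pow R g (m ∸ n) * hEval R K n (pow R t l) ∎
  where
  open CommutativeRing R
  open import Algebra.Properties.CommutativeSemiring.Exp commutativeSemiring using (_^_; ^-congˡ)
  open import Relation.Binary.Reasoning.Setoid setoid
  l : ℕ
  l = suc k
  g g′ : Carrier
  g  = geomSum R l t
  g′ = nonFullSum R k t (1# - t)
  g′≈g : g′ ≈ g
  g′≈g = nonFullSum≈geomSum R k t
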